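{- The map $D\mapsto K_D$ is an order embedding of the partially ordered set $(\overline{\mathbf D},\subseteq)$ into the partially ordered set $(\overline{\mathbf K},\subseteq)$ of all coherent SDSes; its image is exactly the set of all conjunctive coherent SDSes, and on this image its inverse is the map $K\mapsto D_K$. Moreover, if the closure operator $\mathrm{cl}$ is finitary, then $D\mapsto K_D$ is also an order embedding of $(\overline{\mathbf D},\subseteq)$ into the partially ordered set $(\overline{\mathbf K}_{\mathrm{fin}},\subseteq)$ of all finitely coherent SDSes; its image is exactly the set of all conjunctive finitely coherent SDSes, and on this image its inverse is $K\mapsto D_K$.
   Context: Let $\mathcal T$ be a non-empty set (of "things"). Let $\mathrm{cl}:\mathcal P(\mathcal T)\to\mathcal P(\mathcal T)$ be a closure operator: $A\subseteq\mathrm{cl}(A)$, $A\subseteq B\Rightarrow\mathrm{cl}(A)\subseteq\mathrm{cl}(B)$, $\mathrm{cl}(\mathrm{cl}(A))=\mathrm{cl}(A)$ for all $A,B\subseteq\mathcal T$. It is called finitary if $\mathrm{cl}(A)=\bigcup\{\mathrm{cl}(F):F\subseteq A,\ F\text{ finite}\}$ for all $A\subseteq\mathcal T$ (the empty set counts as finite). Let $\mathcal T_-\subseteq\mathcal T$ be a set of forbidden things and put $\mathcal T_+:=\mathrm{cl}(\emptyset)$; standing assumption: $\mathcal T_+\cap\mathcal T_-=\emptyset$. A coherent SDT is a set $D\subseteq\mathcal T$ with $\mathrm{cl}(D)=D$ and $D\cap\mathcal T_-=\emptyset$; $\overline{\mathbf D}$ is the set of all coherent SDTs. For $\mathcal W\subseteq\mathcal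 P(\mathcal T)$, $\Sigma_{\mathcal W}$ is the set of selection maps $\sigma:\mathcal W\to\mathcal T$ with $\sigma(S)\in S$ for all $S\in\mathcal W$, and $\sigma(\mathcal W):=\{\sigma(S):S\in\mathcal W\}$. An SDS is any $K\subseteq\mathcal P(\mathcal T)$. It is coherent if (K1) $\emptyset\notin K$; (K2) if $S_1\in K$ and $S_1\subseteq S_2\subseteq\mathcal T$ then $S_2\in K$; (K3) if $S\in K$ then $S\setminus\mathcal T_-\in K$; (K4) $\{t\}\in K$ for every $t\in\mathcal T_+$; (K5) for every non-empty $\mathcal W\subseteq K$ and every family $(t_\sigma)_{\sigma\in\Sigma_{\mathcal W}}$ with $t_\sigma\in\mathrm{cl}(\sigma(\mathcal W))$, one has $\{t_\sigma:\sigma\in\Sigma_{\mathcal W}\}\in K$. It is finitely coherent if it satisfies K1–K4 and K5 restricted to non-empty finite $\mathcal W\subseteq K$. For $D\subseteq\mathcal T$ let $K_D:=\{S\subseteq\mathcal T:S\cap D\neq\emptyset\}$, and for an SDS $K$ let $D_K:=\{t\in\mathcal T:\{t\}\in K\}$. An SDS $K$ is conjunctive if for every $S\in K$ there is $t\in S$ with $\{t\}\in K$. An order embedding is a map $f$ with $x\le y\iff f(x)\le f(y)$. -}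

module Defs where

open import Level using (0ℓ) renaming (suc to lsuc)
open import Data.Nat using (ℕ)
open import Data.Fin using (Fin)
open import Data.Product using (Σ; ∃; _×_; _,_)
open import Data.Empty using (⊥)
open import Relation.Nullary using (¬_)
open import Relation.Unary
  using (Pred; _∈_; _∉_; _⊆_; _≐_; ∅; ｛_｝; _∩_; _∖_; Satisfiable)
open import Relation.Binary.PropositionalEquality using (_≡_)

-- Subsets of T are predicates T → Set; "S₁ = S₂" for subsets is read
-- extensionally (_≐_).  An SDS is a predicate on subsets.

Subset : Set → Set₁
Subset T = Pred T 0ℓ

SDS : Set → Set₁
SDS T = Pred (Subset T) 0ℓ

record IsClosureOperator {T : Set} (cl : Subset T → Subset T) : Set₁ where
  field
    extensive  : ∀ A → A ⊆ cl A
    monotone   : ∀ A B → A ⊆ B → cl A ⊆ cl B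
    idempotent : ∀ A → cl (cl A) ≐ cl A

Finite : {T : Set} → Subset T → Set
Finite {T} F = Σ ℕ λ n → Σ (Fin n → T) λ g → F ≐ (λ x → ∃ λ i → g i ≡ x)

Finitary : {T : Set} → (Subset T → Subset T) → Set₁
Finitary {T} cl = ∀ (A : Subset T) →
  cl A ≐ (λ t → ∃ λ (F : Subset T) → Finite F × F ⊆ A × t ∈ cl F)

module Framework (T : Set) (cl : Subset T → Subset T) (T₋ : Subset T) where

  T₊ : Subset T
  T₊ = cl ∅

  CoherentSDT : Subset T → Set
  CoherentSDT D = (cl D ≐ D) × (∀ t → t ∈ D → t ∉ T₋)

  Selection : {I : Set} → (I → Subset T) → Set
  Selection {I} e = Σ (I → T) λ σ → ∀ i → σ i ∈ e i

  selImage : {I : Set} {e : I → Subset T} → Selection e → Subset T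
  selImage {I} (σ , _) = λ x → ∃ λ (i : I) → σ i ≡ x

  -- axiom K5 for collections indexed by I (non-empty = "not empty")
  K5-for : (I : Set) → SDS T → Set₁
  K5-for I K =
    (e : I → Subset T) → ¬ ¬ I → (∀ i → e i ∈ K) →
    (t : Selection e → T) → (∀ σ → t σ ∈ cl (selImage {I} {e} σ)) →
    (λ x → ∃ λ (σ : Selection e) → t σ ≡ x) ∈ K

  record K1-4 (K : SDS T) : Set₁ where
    field
      K1 : ∅ ∉ K
      K2 : ∀ (S₁ S₂ : Subset T) → S₁ ∈ K → S₁ ⊆ S₂ → S₂ ∈ K
      K3 : ∀ (S : Subset T) → S ∈ K → (S ∖ T₋) ∈ K
      K4 : ∀ t → t ∈ T₊ → ｛ t ｝ ∈ K

  CoherentSDS : SDS T → Set₁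
  CoherentSDS K = K1-4 K × (∀ (I : Set) → K5-for I K)

  FinCoherentSDS : SDS T → Set₁
  FinCoherentSDS K = K1-4 K × (∀ (n : ℕ) → K5-for (Fin n) K)

  K[_] : Subset T → SDS T
  K[ D ] = λ S → Satisfiable (S ∩ D)

  D[_] : SDS T → Subset T
  D[ K ] = λ t → ｛ t ｝ ∈ K

  Conjunctive : SDS T → Set₁
  Conjunctive K = ∀ S → S ∈ K → ∃ λ t → t ∈ S × ｛ t ｝ ∈ K

  EmbeddingFacts : (SDS T → Set₁) → Set₁
  EmbeddingFacts Coh =
    (∀ D → CoherentSDT D → Coh K[ D ])
    × (∀ D D′ → CoherentSDT D → CoherentSDT D′ → (D ⊆ D′ → K[ D ] ⊆ K[ D′ ]) × (K[ D ] ⊆ K[ D′ ] → D ⊆ D′))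
    × (∀ (K : SDS T) → ((∃ λ D → CoherentSDT D × K ≐ K[ D ]) → Coh K × Conjunctive K)
                     × (Coh K × Conjunctive K → ∃ λ D → CoherentSDT D × K ≐ K[ D ]))
    × (∀ D → CoherentSDT D → D[ K[ D ] ] ≐ D)
    × (∀ K → Coh K → Conjunctive K → CoherentSDT D[ K ] × K[ D[ K ] ] ≐ K)

{-# OPTIONS --safe #-}
-- A coherent SDT D is recovered from K_D as its singletons, and K_D is
-- conjunctive.  Conversely, for a conjunctive SDS K the sets in K are exactly
-- those meeting D_K, so K = K_{D_K}; it remains to see that D_K is a coherent
-- SDT.  Disjointness from T₋ follows from K1–K3 applied to a singleton.
-- Closedness comes from K5 applied to the family of singletons {x}, x ∈ D_K
-- (or, if cl is finitary, x ∈ F for a finite F ⊆ D_K): every selection map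
-- then has image D_K (resp. F), so K5 yields {t} ∈ K for each t ∈ cl D_K.
module Submission where

open import Defs
open import Data.Product using (_×_; _,_; proj₁; proj₂; Σ; ∃)
open import Data.Nat using (zero; suc)
open import Data.Fin as Fin using (Fin)
open import Function using (_∘_)
open import Relation.Nullary using (¬_)
open import Relation.Unary
  using (_∩_; ∅; Empty; _∈_; _∉_; _⊆_; _≐_; ｛_｝; _∖_)
open import Relation.Unary.Properties using (≐-sym)
open import Relation.Binary.PropositionalEquality using (_≡_; refl; sym)

image : {T I : Set} → (I → T) → Subset T
image g = λ x → ∃ λ i → g i ≡ x

module SDTEmbedding (T : Set) (cl : Subset T → Subset T) (T₋ : Subset T)
                    (isClosure : IsClosureOperator cl) where
  open Framework T cl T₋
  open IsClosureOperator isClosure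

  K1-4-respects-≐ : ∀ {K K′} → K ≐ K′ → K1-4 K → K1-4 K′
  K1-4-respects-≐ (K⊆K′ , K′⊆K) k = record
    { K1 = K1 ∘ K′⊆K
    ; K2 = λ S₁ S₂ S₁∈K′ S₁⊆S₂ → K⊆K′ (K2 S₁ S₂ (K′⊆K S₁∈K′) S₁⊆S₂)
    ; K3 = λ S S∈K′ → K⊆K′ (K3 S (K′⊆K S∈K′))
    ; K4 = λ t t∈T₊ → K⊆K′ (K4 t t∈T₊)
    }
    where open K1-4 k

  K5-respects-≐ : ∀ {I K K′} → K ≐ K′ → K5-for I K → K5-for I K′
  K5-respects-≐ (K⊆K′ , K′⊆K) k5 e ne e∈K′ t t∈cl =
    K⊆K′ (k5 e ne (K′⊆K ∘ e∈K′) t t∈cl)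

  module _ {D : Subset T} (coh : CoherentSDT D) where
    private
      closed : cl D ⊆ D
      closed = proj₁ (proj₁ coh)

    K[-]-K1-4 : K1-4 K[ D ]
    K[-]-K1-4 = record
      { K1 = λ { (_ , () , _) }
      ; K2 = λ { _ _ (x , x∈S₁ , x∈D) S₁⊆S₂ → x , S₁⊆S₂ x∈S₁ , x∈D }
      ; K3 = λ { _ (x , x∈S , x∈D) → x , (x∈S , proj₂ coh x x∈D) , x∈D }
      ; K4 = λ t t∈T₊ → t , refl , closed (monotone ∅ D (λ ()) t∈T₊)
      }

    K[-]-K5 : ∀ I → K5-for I K[ D ]
    K[-]-K5 I e _ e∈K t t∈cl = t σ , (σ , refl) , closed (monotone _ D σ⊆D (t∈cl σ))
      where
      σ : Selection e
      σ = proj₁ ∘ e∈K , proj₁ ∘ proj₂ ∘ e∈K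
      σ⊆D : selImage {e = e} σ ⊆ D
      σ⊆D (i , refl) = proj₂ (proj₂ (e∈K i))

  D[K[-]]≐ : ∀ D → D[ K[ D ] ] ≐ D
  D[K[-]]≐ D = (λ { (_ , refl , x∈D) → x∈D }) , (λ x∈D → _ , refl , x∈D)

  K[-]-monotone : ∀ {D D′} → D ⊆ D′ → K[ D ] ⊆ K[ D′ ]
  K[-]-monotone D⊆D′ (x , x∈S , x∈D) = x , x∈S , D⊆D′ x∈D

  K[-]-reflects-⊆ : ∀ {D D′} → K[ D ] ⊆ K[ D′ ] → D ⊆ D′
  K[-]-reflects-⊆ KD⊆KD′ {x} x∈D with KD⊆KD′ {｛ x ｝} (x , refl , x∈D)
  ... | _ , refl , x∈D′ = x∈D′

  ≐K[-]⇒conjunctive : ∀ {K D} → K ≐ K[ D ] → Conjunctive K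
  ≐K[-]⇒conjunctive (K⊆KD , KD⊆K) S S∈K with K⊆KD S∈K
  ... | x , x∈S , x∈D = x , x∈S , KD⊆K (x , refl , x∈D)

  module _ {K : SDS T} (k : K1-4 K) where
    open K1-4 k

    K[D[-]]≐ : Conjunctive K → K[ D[ K ] ] ≐ K
    K[D[-]]≐ conj =
      (λ { {S} (x , x∈S , x∈D) → K2 ｛ x ｝ S x∈D (λ { refl → x∈S }) }) ,
      (λ {S} → conj S)

    D[-]-disjoint : ∀ t → t ∈ D[ K ] → t ∉ T₋
    D[-]-disjoint t t∈D t∈T₋ =
      K1 (K2 (｛ t ｝ ∖ T₋) ∅ (K3 ｛ t ｝ t∈D) (λ { (refl , t∉T₋) → t∉T₋ t∈T₋ }))

    D[-]-coherent : cl D[ K ] ⊆ D[ K ] → CoherentSDT D[ K ]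
    D[-]-coherent closed = (closed , extensive D[ K ]) , D[-]-disjoint

    K5-singletons⇒closed : ∀ {I} → K5-for I K → ¬ ¬ I →
      (g : I → T) → (∀ i → g i ∈ D[ K ]) → cl (image g) ⊆ D[ K ]
    K5-singletons⇒closed k5 ne g g∈D {t} t∈cl =
      K2 _ ｛ t ｝ (k5 (｛_｝ ∘ g) ne g∈D (λ _ → t) t∈cl-selImage)
         (λ { (_ , refl) → refl })
      where
      t∈cl-selImage : ∀ σ → t ∈ cl (selImage {e = ｛_｝ ∘ g} σ)
      t∈cl-selImage (σ , σ∈) =
        monotone (image g) _ (λ { (i , refl) → i , sym (σ∈ i) }) t∈cl

  CoherentSDS⇒closed : ∀ {K} → CoherentSDS K → cl D[ K ] ⊆ D[ K ]
  CoherentSDS⇒closed {K} (k , k5) {t} t∈cl =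
    K5-singletons⇒closed k (k5 I) nonempty proj₁ proj₂
      (monotone D[ K ] _ (λ x∈D → (_ , x∈D) , refl) t∈cl)
    where
    I : Set
    I = Σ T (_∈ D[ K ])
    nonempty : ¬ ¬ I
    nonempty ¬I = ¬I (t , K1-4.K4 k t (monotone D[ K ] ∅ (λ x∈D → ¬I (_ , x∈D)) t∈cl))

  FinCoherentSDS⇒closed : Finitary cl → ∀ {K} → FinCoherentSDS K → cl D[ K ] ⊆ D[ K ]
  FinCoherentSDS⇒closed finitary {K} (k , k5) t∈cl
    with proj₁ (finitary D[ K ]) t∈cl
  ... | F , (zero , g , F⊆img , _) , _ , t∈clF =
    K1-4.K4 k _ (monotone F ∅ (λ x∈F → case-empty (F⊆img x∈F)) t∈clF)
    where
    case-empty : ∀ {x} → x ∈ image g → x ∈ ∅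
    case-empty (() , _)
  ... | F , (suc n , g , F⊆img , img⊆F) , F⊆D , t∈clF =
    K5-singletons⇒closed k (k5 (suc n)) (λ ¬I → ¬I Fin.zero) g
      (λ i → F⊆D (img⊆F (i , refl))) (monotone F (image g) F⊆img t∈clF)

  record CoherenceNotion (Coh : SDS T → Set₁) : Set₁ where
    field
      K[-]-coherent : ∀ {D} → CoherentSDT D → Coh K[ D ]
      respects-≐    : ∀ {K K′} → K ≐ K′ → Coh K → Coh K′
      K1-4-of       : ∀ {K} → Coh K → K1-4 K
      D[-]-closed   : ∀ {K} → Coh K → cl D[ K ] ⊆ D[ K ]

  coherent : CoherenceNotion CoherentSDS
  coherent = record
    { K[-]-coherent = λ coh → K[-]-K1-4 coh , K[-]-K5 coh
    ; respects-≐    = λ K≐K′ (k , k5) → K1-4-respects-≐ K≐K′ k , λ I → K5-respects-≐ K≐K′ (k5 I)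
    ; K1-4-of       = proj₁
    ; D[-]-closed   = CoherentSDS⇒closed
    }

  finitelyCoherent : Finitary cl → CoherenceNotion FinCoherentSDS
  finitelyCoherent finitary = record
    { K[-]-coherent = λ coh → K[-]-K1-4 coh , λ n → K[-]-K5 coh (Fin n)
    ; respects-≐    = λ K≐K′ (k , k5) → K1-4-respects-≐ K≐K′ k , λ n → K5-respects-≐ K≐K′ (k5 n)
    ; K1-4-of       = proj₁
    ; D[-]-closed   = FinCoherentSDS⇒closed finitary
    }

  embeddingFacts : ∀ {Coh} → CoherenceNotion Coh → EmbeddingFacts Coh
  embeddingFacts {Coh} notion =
      (λ _ → K[-]-coherent)
    , (λ _ _ _ _ → K[-]-monotone , K[-]-reflects-⊆)
    , (λ _ → image⇒conjunctive , conjunctive⇒image)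
    , (λ D _ → D[K[-]]≐ D)
    , (λ _ c conj → D[K]-coherent c , K[D[-]]≐ (K1-4-of c) conj)
    where
    open CoherenceNotion notion

    D[K]-coherent : ∀ {K} → Coh K → CoherentSDT D[ K ]
    D[K]-coherent c = D[-]-coherent (K1-4-of c) (D[-]-closed c)

    image⇒conjunctive : ∀ {K} → (∃ λ D → CoherentSDT D × K ≐ K[ D ]) → Coh K × Conjunctive K
    image⇒conjunctive (_ , coh , K≐KD) =
      respects-≐ (≐-sym K≐KD) (K[-]-coherent coh) , ≐K[-]⇒conjunctive K≐KD

    conjunctive⇒image : ∀ {K} → Coh K × Conjunctive K → ∃ λ D → CoherentSDT D × K ≐ K[ D ]
    conjunctive⇒image {K} (c , conj) =
      D[ K ] , D[K]-coherent c , ≐-sym (K[D[-]]≐ (K1-4-of c) conj)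

theorem1 : (T : Set) (cl : Subset T → Subset T) (T₋ : Subset T) →
    ¬ ¬ T → IsClosureOperator cl → Empty (cl ∅ ∩ T₋) →
    Framework.EmbeddingFacts T cl T₋ (Framework.CoherentSDS T cl T₋)
      × (Finitary cl →
         Framework.EmbeddingFacts T cl T₋ (Framework.FinCoherentSDS T cl T₋))
theorem1 T cl T₋ _ isClosure _ =
  embeddingFacts coherent , embeddingFacts ∘ finitelyCoherent
  where open SDTEmbedding T cl T₋ isClosure
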